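{- Let $G$ be a chordal graph and $T\subseteq V(G)$ such that no connected component of $G$ is a clique, $G$ has no bridge, and every vertex not in $T$ has a neighbour in $T$. Let $Q$ be a simplicial clique in $G$. Then $|Q|\geq 3$ and $Q$ contains a vertex of $T$.
   Context: A graph is chordal if every cycle of length at least four has a chord. A bridge is an edge contained in no cycle. A vertex $v$ is simplicial if its closed neighbourhood $N[v]$ is a clique; then $N[v]$ is a simplicial clique. -}

module Defs where

open import Level using (0ℓ)
open import Data.Nat using (ℕ; zero; suc; _≤_)
open import Data.Fin using (Fin; toℕ)
open import Data.Fin.Subset using (Subset; _∈_; _∉_)
open import Data.Product using (Σ; _×_; _,_; ∃; ∃-syntax)
open import Data.Sum using (_⊎_)
open import Relation.Nullary using (¬_; Dec)
open import Relation.Binary.PropositionalEquality using (_≡_; _≢_)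
open import Function.Definitions using (Injective)
open import Function.Bundles using (_⇔_)

record Graph (n : ℕ) : Set₁ where
  field
    Adj    : Fin n → Fin n → Set
    sym    : ∀ {u v} → Adj u v → Adj v u
    irrefl : ∀ {u} → ¬ Adj u u
    dec    : ∀ u v → Dec (Adj u v)
open Graph public

module _ {n : ℕ} (G : Graph n) where

  -- j is the successor of i in the cyclic order on Fin k
  Succ : {k : ℕ} → Fin k → Fin k → Set
  Succ {k} i j = (toℕ j ≡ suc (toℕ i)) ⊎ ((toℕ j ≡ 0) × (suc (toℕ i) ≡ k))

  record Cycle : Set where
    field
      len     : ℕ
      len≥3   : 3 ≤ len
      vtx     : Fin len → Fin n
      inj     : Injective _≡_ _≡_ vtx
      edges   : ∀ i j → Succ i j → Adj G (vtx i) (vtx j)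
  open Cycle public

  HasChord : Cycle → Set
  HasChord C = ∃[ i ] ∃[ j ] (Adj G (vtx C i) (vtx C j) × ¬ Succ i j × ¬ Succ j i)

  Chordal : Set
  Chordal = ∀ (C : Cycle) → 4 ≤ len C → HasChord C

  EdgeOnCycle : Fin n → Fin n → Cycle → Set
  EdgeOnCycle u v C = ∃[ i ] ∃[ j ] (Succ i j ×
    (((vtx C i ≡ u) × (vtx C j ≡ v)) ⊎ ((vtx C i ≡ v) × (vtx C j ≡ u))))

  Bridge : Fin n → Fin n → Set
  Bridge u v = Adj G u v × (∀ (C : Cycle) → ¬ EdgeOnCycle u v C)

  NoBridge : Set
  NoBridge = ∀ u v → ¬ Bridge u v

  data Reach : Fin n → Fin n → Set where
    here : ∀ {u} → Reach u u
    step : ∀ {u v w} → Adj G u v → Reach v w → Reach u w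

  IsCliqueP : (Fin n → Set) → Set
  IsCliqueP P = ∀ u w → P u → P w → u ≢ w → Adj G u w

  IsClique : Subset n → Set
  IsClique Q = IsCliqueP (λ u → u ∈ Q)

  Component : Fin n → Fin n → Set
  Component v u = Reach v u

  NoComponentIsClique : Set
  NoComponentIsClique = ∀ v → ¬ IsCliqueP (Component v)

  ClosedNbhd : Fin n → Fin n → Set
  ClosedNbhd v u = (u ≡ v) ⊎ Adj G v u

  Simplicial : Fin n → Set
  Simplicial v = IsCliqueP (ClosedNbhd v)

  SimplicialClique : Subset n → Set
  SimplicialClique Q = ∃[ v ] (Simplicial v × (∀ u → (u ∈ Q) ⇔ ClosedNbhd v u))

  Dominating : Subset n → Set
  Dominating T = ∀ v → v ∉ T → ∃[ u ] (u ∈ T × Adj G v u)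

-- A simplicial vertex v with N[v] = Q has at least two neighbours: with none, its
-- component is {v}, a clique; with exactly one neighbour u, the edge vu is a bridge,
-- because a vertex on a cycle has two distinct neighbours on it. So |Q| ≥ 3. If v ∉ T
-- it has a neighbour in T, which lies in Q.
module Submission where

open import Defs
open import Data.Nat using (ℕ; _≤_; suc; s≤s; z≤n; _≟_)
open import Data.Nat.Properties using (≤-trans; ≤∧≢⇒<)
open import Data.Fin using (Fin; toℕ; fromℕ; fromℕ<; inject₁) renaming (zero to fzero; suc to fsuc)
open import Data.Fin.Properties using (any?; toℕ-fromℕ; toℕ-fromℕ<; toℕ-inject₁; toℕ<n) renaming (_≟_ to _≟ᶠ_)
open import Data.Fin.Subset using (Subset; _∈_; ∣_∣)
open import Data.Fin.Subset.Properties using (∣p∣≤∣x∷p∣; _∈?_)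
open import Data.Vec using (_∷_; here; there)
open import Data.Product using (_×_; _,_; ∃-syntax)
open import Data.Sum using (_⊎_; inj₁; inj₂)
open import Data.Empty using (⊥-elim)
open import Relation.Nullary using (¬_; yes; no)
open import Relation.Nullary.Decidable using (_×-dec_; ¬?)
open import Relation.Binary.PropositionalEquality using (_≡_; _≢_; refl; trans; cong) renaming (sym to ≡-sym)
open import Function using (_∘_)
open import Function.Bundles using (Equivalence)

∈⇒1≤∣p∣ : ∀ {n} {x : Fin n} {p : Subset n} → x ∈ p → 1 ≤ ∣ p ∣
∈⇒1≤∣p∣ here = s≤s z≤n
∈⇒1≤∣p∣ {p = s ∷ p} (there x∈p) = ≤-trans (∈⇒1≤∣p∣ x∈p) (∣p∣≤∣x∷p∣ s p)

∈₂⇒2≤∣p∣ : ∀ {n} {x y : Fin n} {p : Subset n} → x ∈ p → y ∈ p → x ≢ y → 2 ≤ ∣ p ∣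
∈₂⇒2≤∣p∣ here here x≢y = ⊥-elim (x≢y refl)
∈₂⇒2≤∣p∣ here (there y∈p) _ = s≤s (∈⇒1≤∣p∣ y∈p)
∈₂⇒2≤∣p∣ (there x∈p) here _ = s≤s (∈⇒1≤∣p∣ x∈p)
∈₂⇒2≤∣p∣ {p = s ∷ p} (there x∈p) (there y∈p) x≢y =
  ≤-trans (∈₂⇒2≤∣p∣ x∈p y∈p (x≢y ∘ cong fsuc)) (∣p∣≤∣x∷p∣ s p)

∈₃⇒3≤∣p∣ : ∀ {n} {x y z : Fin n} {p : Subset n} → x ∈ p → y ∈ p → z ∈ p →
  x ≢ y → x ≢ z → y ≢ z → 3 ≤ ∣ p ∣
∈₃⇒3≤∣p∣ here here _ x≢y _ _ = ⊥-elim (x≢y refl)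
∈₃⇒3≤∣p∣ here _ here _ x≢z _ = ⊥-elim (x≢z refl)
∈₃⇒3≤∣p∣ _ here here _ _ y≢z = ⊥-elim (y≢z refl)
∈₃⇒3≤∣p∣ here (there y∈p) (there z∈p) _ _ y≢z = s≤s (∈₂⇒2≤∣p∣ y∈p z∈p (y≢z ∘ cong fsuc))
∈₃⇒3≤∣p∣ (there x∈p) here (there z∈p) _ x≢z _ = s≤s (∈₂⇒2≤∣p∣ x∈p z∈p (x≢z ∘ cong fsuc))
∈₃⇒3≤∣p∣ (there x∈p) (there y∈p) here x≢y _ _ = s≤s (∈₂⇒2≤∣p∣ x∈p y∈p (x≢y ∘ cong fsuc))
∈₃⇒3≤∣p∣ {p = s ∷ p} (there x∈p) (there y∈p) (there z∈p) x≢y x≢z y≢z =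
  ≤-trans (∈₃⇒3≤∣p∣ x∈p y∈p z∈p (x≢y ∘ cong fsuc) (x≢z ∘ cong fsuc) (y≢z ∘ cong fsuc))
          (∣p∣≤∣x∷p∣ s p)

cyclic-succ-asym : ∀ a b k → (b ≡ suc a ⊎ ((b ≡ 0) × (suc a ≡ k))) →
  (a ≡ suc b ⊎ ((a ≡ 0) × (suc b ≡ k))) → ¬ 3 ≤ k
cyclic-succ-asym a .(suc a) k (inj₁ refl) (inj₁ ())
cyclic-succ-asym .0 .1 .2 (inj₁ refl) (inj₂ (refl , refl)) (s≤s (s≤s ()))
cyclic-succ-asym .1 .0 .2 (inj₂ (refl , refl)) (inj₁ refl) (s≤s (s≤s ()))
cyclic-succ-asym .0 .0 .1 (inj₂ (refl , refl)) (inj₂ (refl , _)) (s≤s ())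

module _ {n : ℕ} (G : Graph n) where

  successor : ∀ {k} (i : Fin k) → ∃[ j ] Succ G i j
  successor {suc k} i with suc (toℕ i) ≟ suc k
  ... | yes last = fzero , inj₂ (refl , last)
  ... | no ¬last = fromℕ< i<k , inj₁ (toℕ-fromℕ< i<k)
    where i<k = ≤∧≢⇒< (toℕ<n i) ¬last

  predecessor : ∀ {k} (i : Fin k) → ∃[ j ] Succ G j i
  predecessor {suc k} fzero    = fromℕ k , inj₂ (refl , cong suc (toℕ-fromℕ k))
  predecessor {suc k} (fsuc i) = inject₁ i , inj₁ (cong suc (≡-sym (toℕ-inject₁ i)))

  Succ-asym : ∀ {k} {i j : Fin k} → 3 ≤ k → Succ G i j → ¬ Succ G j i
  Succ-asym {k} {i} {j} 3≤k i→j j→i = cyclic-succ-asym (toℕ i) (toℕ j) k i→j j→i 3≤k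

  cycle-vertex-has-two-neighbours : ∀ (C : Cycle G) i →
    ∃[ u ] ∃[ w ] (Adj G (vtx C i) u × Adj G (vtx C i) w × u ≢ w)
  cycle-vertex-has-two-neighbours C i with predecessor i | successor i
  ... | p , p→i | s , i→s =
    vtx C p , vtx C s , Graph.sym G (edges C p i p→i) , edges C i s i→s , p≢s ∘ inj C
    where
    p≢s : p ≢ s
    p≢s refl = Succ-asym (len≥3 C) p→i i→s

  endpoint-on-cycle : ∀ {v u} (C : Cycle G) → EdgeOnCycle G v u C → ∃[ m ] vtx C m ≡ v
  endpoint-on-cycle C (i , _ , _ , inj₁ (vi≡v , _)) = i , vi≡v
  endpoint-on-cycle C (_ , j , _ , inj₂ (_ , vj≡v)) = j , vj≡v

  unique-neighbour⇒edge-on-no-cycle : ∀ {v u} → (∀ w → Adj G v w → w ≡ u) →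
    ∀ (C : Cycle G) → ¬ EdgeOnCycle G v u C
  unique-neighbour⇒edge-on-no-cycle only C on with endpoint-on-cycle C on
  ... | m , refl with cycle-vertex-has-two-neighbours C m
  ...   | w₁ , w₂ , a₁ , a₂ , w₁≢w₂ = w₁≢w₂ (trans (only w₁ a₁) (≡-sym (only w₂ a₂)))

  isolated⇒component-is-clique : ∀ {v} → (∀ w → ¬ Adj G v w) → IsCliqueP G (Component G v)
  isolated⇒component-is-clique {v} isolated u w v⇝u v⇝w u≢w =
    ⊥-elim (u≢w (trans (≡-sym (only-self v⇝u)) (only-self v⇝w)))
    where
    only-self : ∀ {x} → Reach G v x → v ≡ x
    only-self here       = refl
    only-self (step a _) = ⊥-elim (isolated _ a)

  has-two-neighbours : NoComponentIsClique G → NoBridge G →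
    ∀ v → ∃[ u ] ∃[ w ] (Adj G v u × Adj G v w × u ≢ w)
  has-two-neighbours no-clique no-bridge v with any? (dec G v)
  ... | no ¬nbr = ⊥-elim (no-clique v (isolated⇒component-is-clique (λ w a → ¬nbr (w , a))))
  ... | yes (u , vu) with any? (λ w → dec G v w ×-dec ¬? (w ≟ᶠ u))
  ...   | yes (w , vw , w≢u) = u , w , vu , vw , w≢u ∘ ≡-sym
  ...   | no ¬other = ⊥-elim (no-bridge v u (vu , unique-neighbour⇒edge-on-no-cycle only))
    where
    only : ∀ w → Adj G v w → w ≡ u
    only w vw with w ≟ᶠ u
    ... | yes w≡u = w≡u
    ... | no w≢u  = ⊥-elim (¬other (w , vw , w≢u))

corollary6 : ∀ {n : ℕ} (G : Graph n) (T : Subset n) →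
    Chordal G → NoComponentIsClique G → NoBridge G → Dominating G T →
    ∀ (Q : Subset n) → SimplicialClique G Q →
    (3 ≤ ∣ Q ∣) × (∃[ v ] (v ∈ Q × v ∈ T))
corollary6 G T _ no-clique no-bridge dominating Q (v , _ , Q≡N[v]) = size , meets-T
  where
  N[v]⊆Q : ∀ u → ClosedNbhd G v u → u ∈ Q
  N[v]⊆Q u = Equivalence.from (Q≡N[v] u)

  not-v : ∀ {u} → Adj G v u → v ≢ u
  not-v vu refl = irrefl G vu

  size : 3 ≤ ∣ Q ∣
  size with has-two-neighbours G no-clique no-bridge v
  ... | u , w , vu , vw , u≢w =
    ∈₃⇒3≤∣p∣ (N[v]⊆Q v (inj₁ refl)) (N[v]⊆Q u (inj₂ vu)) (N[v]⊆Q w (inj₂ vw))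
             (not-v vu) (not-v vw) u≢w

  meets-T : ∃[ u ] (u ∈ Q × u ∈ T)
  meets-T with v ∈? T
  ... | yes v∈T = v , N[v]⊆Q v (inj₁ refl) , v∈T
  ... | no v∉T with dominating v v∉T
  ...   | u , u∈T , vu = u , N[v]⊆Q u (inj₂ vu) , u∈T
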